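{- Let $G$ and $H$ be finite simple graphs that are not complete. Then $$A_b(G\vee H)=\max\{A_b(G)+n_H,\;A_b(H)+n_G\}.$$ Moreover, for any finite simple graph $G$ and any $q\geq 1$, $A_b(G\vee K_q)=A_b(G)+q$.
   Context: $n_G$ is the number of vertices of $G$. The join $G\vee H$ is obtained from disjoint copies of $G$ and $H$ by adding all edges between $V(G)$ and $V(H)$. A (proper) $k$-coloring of $G$ is a map $c:V(G)\to[k]$ with adjacent vertices colored differently, all $k$ colors used; $V_i=c^{ -1}(i)$. A coloring is acyclic if $G[V_i\cup V_j]$ is a forest for all $i,j$. A vertex $v$ is a b-vertex if the colors on $v$ and its neighbors are all $k$ colors. A recoloring step applied to $c$ and a color $i$ having no b-vertex recolors every $v\in V_i$ with a color not appearing on $v$ or its neighbors, producing a $(k-1)$-coloring; if both colorings are acyclic it is an acyclic recoloring step. The acyclic b-chromatic number $A_b(G)$ is the maximum number of colors of an acyclic coloring of $G$ to which no acyclic recoloring step can be applied. -}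

module Defs where

open import Data.Nat using (ℕ; zero; suc; _+_; _≤_)
open import Data.Fin using (Fin; zero; suc; inject₁; fromℕ; splitAt; _≟_)
open import Data.Bool using (Bool; true; false; not)
open import Data.Sum using (_⊎_; inj₁; inj₂)
open import Data.Product using (Σ; ∃; _×_; _,_)
open import Data.Empty using (⊥)
open import Relation.Nullary using (¬_; yes; no)
open import Relation.Nullary.Decidable using (⌊_⌋)
open import Relation.Binary.PropositionalEquality using (_≡_; _≢_; refl; sym)
open import Function.Definitions using (Injective)

record Graph : Set where
  field
    n      : ℕ
    adj    : Fin n → Fin n → Bool
    adj-sym    : ∀ u v → adj u v ≡ adj v u
    adj-irrefl : ∀ v → adj v v ≡ false
open Graph public

Adj : (G : Graph) → Fin (n G) → Fin (n G) → Set
Adj G u v = adj G u v ≡ true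

Complete : Graph → Set
Complete G = ∀ u v → u ≢ v → Adj G u v

private
  adj⊎ : ∀ {a b} → (Fin a → Fin a → Bool) → (Fin b → Fin b → Bool)
       → Fin a ⊎ Fin b → Fin a ⊎ Fin b → Bool
  adj⊎ f g (inj₁ x) (inj₁ y) = f x y
  adj⊎ f g (inj₂ x) (inj₂ y) = g x y
  adj⊎ f g (inj₁ x) (inj₂ y) = true
  adj⊎ f g (inj₂ x) (inj₁ y) = true

  adj⊎-sym : ∀ {a b} (f : Fin a → Fin a → Bool) (g : Fin b → Fin b → Bool)
           → (∀ x y → f x y ≡ f y x) → (∀ x y → g x y ≡ g y x)
           → ∀ x y → adj⊎ f g x y ≡ adj⊎ f g y x
  adj⊎-sym f g fs gs (inj₁ x) (inj₁ y) = fs x y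
  adj⊎-sym f g fs gs (inj₂ x) (inj₂ y) = gs x y
  adj⊎-sym f g fs gs (inj₁ x) (inj₂ y) = refl
  adj⊎-sym f g fs gs (inj₂ x) (inj₁ y) = refl

  adj⊎-irr : ∀ {a b} (f : Fin a → Fin a → Bool) (g : Fin b → Fin b → Bool)
           → (∀ x → f x x ≡ false) → (∀ x → g x x ≡ false)
           → ∀ x → adj⊎ f g x x ≡ false
  adj⊎-irr f g fi gi (inj₁ x) = fi x
  adj⊎-irr f g fi gi (inj₂ x) = gi x

_∨_ : Graph → Graph → Graph
G ∨ H = record
  { n = n G + n H
  ; adj = λ u v → adj⊎ (adj G) (adj H) (splitAt (n G) u) (splitAt (n G) v)
  ; adj-sym = λ u v → adj⊎-sym (adj G) (adj H) (adj-sym G) (adj-sym H)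
                        (splitAt (n G) u) (splitAt (n G) v)
  ; adj-irrefl = λ v → adj⊎-irr (adj G) (adj H) (adj-irrefl G) (adj-irrefl H)
                        (splitAt (n G) v)
  }

private
  kadj : ∀ {q} → Fin q → Fin q → Bool
  kadj u v = not ⌊ u ≟ v ⌋

  kadj-sym : ∀ {q} (u v : Fin q) → kadj u v ≡ kadj v u
  kadj-sym u v with u ≟ v | v ≟ u
  ... | yes _ | yes _ = refl
  ... | no _  | no _  = refl
  ... | yes p | no ¬q with ¬q (sym p)
  ... | ()
  kadj-sym u v | no ¬p | yes q with ¬p (sym q)
  ... | ()

  kadj-irr : ∀ {q} (v : Fin q) → kadj v v ≡ false
  kadj-irr v with v ≟ v
  ... | yes _ = refl
  ... | no ¬p with ¬p refl
  ... | ()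

K : ℕ → Graph
K q = record { n = q ; adj = kadj ; adj-sym = kadj-sym ; adj-irrefl = kadj-irr }

Proper : (G : Graph) {k : ℕ} → (Fin (n G) → Fin k) → Set
Proper G c = ∀ u v → Adj G u v → c u ≢ c v

AllColorsUsed : (G : Graph) {k : ℕ} → (Fin (n G) → Fin k) → Set
AllColorsUsed G {k} c = ∀ (i : Fin k) → ∃ λ v → c v ≡ i

IsColoring : (G : Graph) (k : ℕ) → (Fin (n G) → Fin k) → Set
IsColoring G k c = Proper G c × AllColorsUsed G c

CycleIn : (G : Graph) → (Fin (n G) → Set) → Set
CycleIn G P =
  Σ ℕ λ l → Σ (Fin (3 + l) → Fin (n G)) λ w →
    Injective _≡_ _≡_ w
    × (∀ t → P (w t))
    × (∀ (t : Fin (2 + l)) → Adj G (w (inject₁ t)) (w (suc t)))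
    × Adj G (w (fromℕ (2 + l))) (w zero)

Acyclic : (G : Graph) {k : ℕ} → (Fin (n G) → Fin k) → Set
Acyclic G {k} c = ∀ (i j : Fin k) → ¬ CycleIn G (λ v → c v ≡ i ⊎ c v ≡ j)

IsBVertex : (G : Graph) {k : ℕ} → (Fin (n G) → Fin k) → Fin (n G) → Set
IsBVertex G {k} c v =
  ∀ (j : Fin k) → c v ≡ j ⊎ (∃ λ u → Adj G v u × c u ≡ j)

NoBVertex : (G : Graph) {k : ℕ} → (Fin (n G) → Fin k) → Fin k → Set
NoBVertex G c i = ∀ v → c v ≡ i → ¬ IsBVertex G c v

-- c' is a result of the recoloring step applied to c and color i:
-- every v ∈ V_i receives a color not appearing on v or its neighbours (in c),
-- all other vertices keep their color. (c' uses the k-1 colors other than i.)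
RecoloringStep : (G : Graph) {k : ℕ} → (Fin (n G) → Fin k) → Fin k
               → (Fin (n G) → Fin k) → Set
RecoloringStep G c i c' =
    (∀ v → c v ≢ i → c' v ≡ c v)
  × (∀ v → c v ≡ i → c' v ≢ c v × (∀ u → Adj G v u → c' v ≢ c u))

AcyclicStepApplicable : (G : Graph) {k : ℕ} → (Fin (n G) → Fin k) → Set
AcyclicStepApplicable G {k} c =
  Σ (Fin k) λ i → NoBVertex G c i ×
    (Σ (Fin (n G) → Fin k) λ c' → RecoloringStep G c i c' × Acyclic G c')

IsAbColoring : (G : Graph) (k : ℕ) → (Fin (n G) → Fin k) → Set
IsAbColoring G k c = IsColoring G k c × Acyclic G c × ¬ AcyclicStepApplicable G c

IsAb : Graph → ℕ → Set
IsAb G m =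
    (Σ (Fin (n G) → Fin m) λ c → IsAbColoring G m c)
  × (∀ (k : ℕ) (c : Fin (n G) → Fin k) → IsAbColoring G k c → k ≤ m)

module Submission where

-- In an acyclic coloring of a join A ∨ B one side is colored injectively, since a color repeated
-- in A and a color repeated in B span a two-colored 4-cycle. If A is the injective side, its
-- colors are disjoint from those of B, and the coloring of B, renumbered by its image, is again an
-- A_b-coloring: every acyclic recoloring step of B lifts to A ∨ B. Hence k ≤ A_b(B) + n_A.
-- Conversely, an A_b-coloring of B with n_A fresh colors on A is an A_b-coloring of A ∨ B: steps on
-- a color of B restrict to B, and a step on the color of a ∈ A must move a to the color of a
-- non-neighbor in A, which closes a two-colored 4-cycle as soon as the coloring of B repeats a
-- color.

open import Defs
open import Data.Nat using (ℕ; zero; suc; _+_; _⊔_; _≤_)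
open import Data.Nat.Properties using (≤-total; ≤-trans; +-monoˡ-≤; m≤m⊔n; m≤n⊔m; m≤n⇒m⊔n≡n; m≥n⇒m⊔n≡m)
open import Data.Fin using (Fin; zero; suc; inject₁; fromℕ; splitAt; _↑ˡ_; _↑ʳ_)
  renaming (_≟_ to _≟ᶠ_)
open import Data.Fin.Patterns using (0F; 1F; 2F; 3F)
open import Data.Fin.Properties
  using (any?; injective⇒≤; splitAt-↑ˡ; splitAt-↑ʳ; join-splitAt; ↑ˡ-injective; ↑ʳ-injective)
open import Data.Bool using (true; not)
import Data.Bool.Properties as Bool
open import Data.Vec using (Vec; _∷_; []; lookup)
open import Data.Vec.Relation.Unary.All using (_∷_; [])
open import Data.Vec.Relation.Unary.AllPairs using (_∷_; [])
open import Data.Vec.Relation.Unary.Unique.Propositional using (Unique)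
open import Data.Vec.Relation.Unary.Unique.Propositional.Properties using (lookup-injective)
open import Data.Sum using (_⊎_; inj₁; inj₂; [_,_]′; reduce)
import Data.Sum as Sum
open import Data.Product using (Σ; ∃; ∃₂; _×_; _,_; proj₁; proj₂)
open import Data.Empty using (⊥; ⊥-elim)
open import Function using (_∘_; id)
open import Function.Definitions using (Injective)
open import Relation.Nullary using (¬_; yes; no)
open import Relation.Nullary.Decidable using (¬?; _×-dec_; ⌊_⌋)
open import Relation.Binary.Definitions using (Decidable)
open import Relation.Binary.PropositionalEquality
  using (_≡_; _≢_; refl; sym; trans; cong; subst; subst₂; module ≡-Reasoning)

↑ˡ≢↑ʳ : ∀ {m n} (y : Fin m) (a : Fin n) → y ↑ˡ n ≢ m ↑ʳ a
↑ˡ≢↑ʳ {m} {n} y a eq with trans (sym (splitAt-↑ˡ m y n)) (trans (cong (splitAt m) eq) (splitAt-↑ʳ m n a))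
... | ()

↑-view : ∀ m n (j : Fin (m + n)) → (∃ λ y → j ≡ y ↑ˡ n) ⊎ (∃ λ a → j ≡ m ↑ʳ a)
↑-view m n j with splitAt m j | join-splitAt m n j
... | inj₁ y | eq = inj₁ (y , sym eq)
... | inj₂ a | eq = inj₂ (a , sym eq)

Collision : ∀ {a k} → (Fin a → Fin k) → Set
Collision f = ∃₂ λ u v → u ≢ v × f u ≡ f v

injective⊎collision : ∀ {a k} (f : Fin a → Fin k) → Injective _≡_ _≡_ f ⊎ Collision f
injective⊎collision f with any? (λ u → any? (λ v → ¬? (u ≟ᶠ v) ×-dec (f u ≟ᶠ f v)))
... | yes collision = inj₂ collision
... | no ¬collision = inj₁ injective
  where
  injective : Injective _≡_ _≡_ f
  injective {u} {v} fu≡fv with u ≟ᶠ v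
  ... | yes u≡v = u≡v
  ... | no u≢v = ⊥-elim (¬collision (u , v , u≢v , fu≡fv))

surjective⇒≤ : ∀ {a k} (f : Fin a → Fin k) → (∀ j → ∃ λ i → f i ≡ j) → k ≤ a
surjective⇒≤ f onto = injective⇒≤ {f = proj₁ ∘ onto} λ {x} {y} eq →
  trans (sym (proj₂ (onto x))) (trans (cong f eq) (proj₂ (onto y)))

record ImageFactorization {a k} (h : Fin a → Fin k) : Set where
  field
    size : ℕ
    onto : Fin a → Fin size
    into : Fin size → Fin k
    onto-surjective : ∀ j → ∃ λ v → onto v ≡ j
    into-injective : Injective _≡_ _≡_ into
    factors : ∀ v → h v ≡ into (onto v)

imageFactorization : ∀ {a k} (h : Fin a → Fin k) → ImageFactorization h
imageFactorization {zero} h = record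
  { size = 0 ; onto = λ () ; into = λ () ; onto-surjective = λ ()
  ; into-injective = λ {} ; factors = λ () }
imageFactorization {suc a} {k} h with imageFactorization (h ∘ suc)
... | record { size = m ; onto = g ; into = e ; onto-surjective = g-onto
             ; into-injective = e-inj ; factors = h∘suc≡e∘g }
  with any? (λ x → e x ≟ᶠ h zero)
...   | yes (x , ex≡h₀) = record
  { size = m ; onto = g′ ; into = e ; onto-surjective = g′-onto
  ; into-injective = e-inj ; factors = factors′ }
  where
  g′ : Fin (suc a) → Fin m
  g′ zero = x
  g′ (suc v) = g v
  g′-onto : ∀ j → ∃ λ v → g′ v ≡ j
  g′-onto j = suc (proj₁ (g-onto j)) , proj₂ (g-onto j)
  factors′ : ∀ v → h v ≡ e (g′ v)
  factors′ zero = sym ex≡h₀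
  factors′ (suc v) = h∘suc≡e∘g v
...   | no h₀∉image = record
  { size = suc m ; onto = g′ ; into = e′ ; onto-surjective = g′-onto
  ; into-injective = e′-inj ; factors = factors′ }
  where
  g′ : Fin (suc a) → Fin (suc m)
  g′ zero = zero
  g′ (suc v) = suc (g v)
  e′ : Fin (suc m) → Fin k
  e′ zero = h zero
  e′ (suc x) = e x
  g′-onto : ∀ j → ∃ λ v → g′ v ≡ j
  g′-onto zero = zero , refl
  g′-onto (suc j) = suc (proj₁ (g-onto j)) , cong suc (proj₂ (g-onto j))
  e′-inj : Injective _≡_ _≡_ e′
  e′-inj {zero} {zero} _ = refl
  e′-inj {zero} {suc y} eq = ⊥-elim (h₀∉image (y , sym eq))
  e′-inj {suc x} {zero} eq = ⊥-elim (h₀∉image (x , eq))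
  e′-inj {suc x} {suc y} eq = cong suc (e-inj eq)
  factors′ : ∀ v → h v ≡ e′ (g′ v)
  factors′ zero = refl
  factors′ (suc v) = h∘suc≡e∘g v

Adj-sym : ∀ G {u v} → Adj G u v → Adj G v u
Adj-sym G {u} {v} = trans (adj-sym G v u)

Adj⇒≢ : ∀ G {u v} → Adj G u v → u ≢ v
Adj⇒≢ G {u} uv refl with trans (sym uv) (adj-irrefl G u)
... | ()

Adj? : ∀ G → Decidable (Adj G)
Adj? G u v = adj G u v Bool.≟ true

¬Complete⇒nonEdge : ∀ G → ¬ Complete G → ∃₂ λ u v → u ≢ v × ¬ Adj G u v
¬Complete⇒nonEdge G ¬complete
  with any? (λ u → any? (λ v → ¬? (u ≟ᶠ v) ×-dec ¬? (Adj? G u v)))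
... | yes (u , v , nonEdge) = u , v , nonEdge
... | no ¬nonEdge = ⊥-elim (¬complete complete)
  where
  complete : Complete G
  complete u v u≢v with Adj? G u v
  ... | yes uv = uv
  ... | no ¬uv = ⊥-elim (¬nonEdge (u , v , u≢v , ¬uv))

K-complete : ∀ q → Complete (K q)
K-complete q u v u≢v = distinct⇒true
  where
  distinct⇒true : not ⌊ u ≟ᶠ v ⌋ ≡ true
  distinct⇒true with u ≟ᶠ v
  ... | yes u≡v = ⊥-elim (u≢v u≡v)
  ... | no _ = refl

CycleIn-mono : ∀ G {P Q : Fin (n G) → Set} → (∀ {v} → P v → Q v) → CycleIn G P → CycleIn G Q
CycleIn-mono G P⇒Q (l , w , w-inj , Pw , step , close) = l , w , w-inj , P⇒Q ∘ Pw , step , close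

CycleIn-map : ∀ B X {Q : Fin (n B) → Set} {P : Fin (n X) → Set} (f : Fin (n B) → Fin (n X))
  → Injective _≡_ _≡_ f → (∀ {u v} → Adj B u v → Adj X (f u) (f v)) → (∀ {v} → Q v → P (f v))
  → CycleIn B Q → CycleIn X P
CycleIn-map B X f f-inj f-adj Q⇒P (l , w , w-inj , Qw , step , close) =
  l , f ∘ w , w-inj ∘ f-inj , Q⇒P ∘ Qw , f-adj ∘ step , f-adj close

CycleIn-pull : ∀ B X {P : Fin (n X) → Set} (f : Fin (n B) → Fin (n X))
  → (∀ {u v} → Adj X (f u) (f v) → Adj B u v) → (∀ {v} → P v → ∃ λ b → f b ≡ v)
  → CycleIn X P → CycleIn B (P ∘ f)
CycleIn-pull B X {P} f f-adj⁻ P⊆image (l , w , w-inj , Pw , step , close) =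
  l , w′ , w′-inj , (λ t → subst P (sym (w′-lifts t)) (Pw t)) ,
  (λ t → f-adj⁻ (subst₂ (Adj X) (sym (w′-lifts _)) (sym (w′-lifts _)) (step t))) ,
  f-adj⁻ (subst₂ (Adj X) (sym (w′-lifts _)) (sym (w′-lifts _)) close)
  where
  w′ : Fin (3 + l) → Fin (n B)
  w′ t = proj₁ (P⊆image (Pw t))
  w′-lifts : ∀ t → f (w′ t) ≡ w t
  w′-lifts t = proj₂ (P⊆image (Pw t))
  w′-inj : Injective _≡_ _≡_ w′
  w′-inj {s} {t} eq = w-inj (trans (sym (w′-lifts s)) (trans (cong f eq) (w′-lifts t)))

CycleIn-square : ∀ G {P : Fin (n G) → Set} {v₀ v₁ v₂ v₃}
  → Unique (v₀ ∷ v₁ ∷ v₂ ∷ v₃ ∷ []) → P v₀ → P v₁ → P v₂ → P v₃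
  → Adj G v₀ v₁ → Adj G v₁ v₂ → Adj G v₂ v₃ → Adj G v₃ v₀ → CycleIn G P
CycleIn-square G {P} {v₀} {v₁} {v₂} {v₃} distinct p₀ p₁ p₂ p₃ a₀₁ a₁₂ a₂₃ a₃₀ =
  1 , lookup vs , (λ {s} {t} → lookup-injective distinct s t) , Pvs , step , a₃₀
  where
  vs : Vec (Fin (n G)) 4
  vs = v₀ ∷ v₁ ∷ v₂ ∷ v₃ ∷ []
  Pvs : ∀ t → P (lookup vs t)
  Pvs 0F = p₀
  Pvs 1F = p₁
  Pvs 2F = p₂
  Pvs 3F = p₃
  step : ∀ (t : Fin 3) → Adj G (lookup vs (inject₁ t)) (lookup vs (suc t))
  step 0F = a₀₁
  step 1F = a₁₂
  step 2F = a₂₃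

¬CycleIn-star : ∀ G {P : Fin (n G) → Set} x
  → (∀ {u v} → P u → P v → Adj G u v → u ≡ x ⊎ v ≡ x) → ¬ CycleIn G P
¬CycleIn-star G x meets (l , w , w-inj , Pw , step , close) =
  [ w₀≢x , w₁≢x ]′ (meets (Pw 0F) (Pw 1F) (step 0F))
  where
  apart : ∀ {s t} → s ≢ t → w s ≡ x → w t ≡ x → ⊥
  apart s≢t ws wt = s≢t (w-inj (trans ws (sym wt)))
  w₀≢x : w 0F ≢ x
  w₀≢x w₀ = [ apart (λ ()) w₀ , apart (λ ()) w₀ ]′ (meets (Pw 1F) (Pw 2F) (step 1F))
  w₁≢x : w 1F ≢ x
  w₁≢x w₁ = [ (λ wₗ → apart (λ ()) wₗ w₁) , (λ w₀ → apart (λ ()) w₀ w₁) ]′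
              (meets (Pw (fromℕ (2 + l))) (Pw 0F) close)

¬CycleIn-monochromatic : ∀ G {k} {d : Fin (n G) → Fin k} {i} → Proper G d
  → ¬ CycleIn G (λ v → d v ≡ i ⊎ d v ≡ i)
¬CycleIn-monochromatic G d-proper (_ , w , _ , Pw , step , _) =
  d-proper (w 0F) (w 1F) (step 0F) (trans (reduce (Pw 0F)) (sym (reduce (Pw 1F))))

-- Every edge inside the colors i, j has an endpoint of color i, and that is the star center.
unique-color⇒¬CycleIn : ∀ G {k} {d : Fin (n G) → Fin k} {i j} → Proper G d
  → (∀ {x y} → d x ≡ i → d y ≡ i → x ≡ y) → ¬ CycleIn G (λ v → d v ≡ i ⊎ d v ≡ j)
unique-color⇒¬CycleIn G {d = d} {i} {j} d-proper i-unique cycle@(_ , w , _ , Pw , step , _) =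
  ¬CycleIn-star G center meets cycle
  where
  endpoint-colored-i : ∀ {u v} → d u ≡ i ⊎ d u ≡ j → d v ≡ i ⊎ d v ≡ j → Adj G u v
    → d u ≡ i ⊎ d v ≡ i
  endpoint-colored-i (inj₁ du) _ _ = inj₁ du
  endpoint-colored-i (inj₂ _) (inj₁ dv) _ = inj₂ dv
  endpoint-colored-i (inj₂ du) (inj₂ dv) uv = ⊥-elim (d-proper _ _ uv (trans du (sym dv)))
  center-colored-i : ∃ λ x → d x ≡ i
  center-colored-i = [ (w 0F ,_) , (w 1F ,_) ]′ (endpoint-colored-i (Pw 0F) (Pw 1F) (step 0F))
  center = proj₁ center-colored-i
  meets : ∀ {u v} → d u ≡ i ⊎ d u ≡ j → d v ≡ i ⊎ d v ≡ j → Adj G u v → u ≡ center ⊎ v ≡ center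
  meets Pu Pv uv = Sum.map (λ du → i-unique du (proj₂ center-colored-i))
                           (λ dv → i-unique dv (proj₂ center-colored-i))
                           (endpoint-colored-i Pu Pv uv)

acyclic-if-one-color-repeats : ∀ G {k} {d : Fin (n G) → Fin k} (r : Fin k) → Proper G d
  → (∀ {i x y} → i ≢ r → d x ≡ i → d y ≡ i → x ≡ y) → Acyclic G d
acyclic-if-one-color-repeats G {d = d} r d-proper unique i j with i ≟ᶠ r | j ≟ᶠ r
... | no i≢r | _ = unique-color⇒¬CycleIn G d-proper (unique i≢r)
... | yes _ | no j≢r = λ cycle →
  unique-color⇒¬CycleIn G d-proper (unique j≢r) (CycleIn-mono G {Q = λ v → d v ≡ j ⊎ d v ≡ i} Sum.swap cycle)
... | yes refl | yes refl = ¬CycleIn-monochromatic G d-proper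

Acyclic-reindex : ∀ G {m k} {c : Fin (n G) → Fin m} {d : Fin (n G) → Fin k} (e : Fin m → Fin k)
  → Injective _≡_ _≡_ e → (∀ v → d v ≡ e (c v)) → Acyclic G c → Acyclic G d
Acyclic-reindex G {c = c} {d} e e-inj d≡e∘c c-acyclic i j cycle@(_ , w , _) =
  c-acyclic (proj₁ (preimage i)) (proj₁ (preimage j))
    (CycleIn-mono G (λ {v} → Sum.map (proj₂ (preimage i) {v}) (proj₂ (preimage j) {v})) cycle)
  where
  preimage : ∀ i → ∃ λ i′ → ∀ {v} → d v ≡ i → c v ≡ i′
  preimage i with any? (λ x → e x ≟ᶠ i)
  ... | yes (i′ , ei′) = i′ , λ {v} dv → e-inj (trans (sym (d≡e∘c v)) (trans dv (sym ei′)))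
  -- a color outside the image of e occurs nowhere, so any preimage will do
  ... | no ∉image = c (w 0F) , λ {v} dv → ⊥-elim (∉image (c v , trans (sym (d≡e∘c v)) dv))

Acyclic-pullback : ∀ B X {m k} {g : Fin (n B) → Fin m} {c : Fin (n X) → Fin k}
  (f : Fin (n B) → Fin (n X)) (e : Fin m → Fin k)
  → Injective _≡_ _≡_ f → (∀ {u v} → Adj B u v → Adj X (f u) (f v))
  → (∀ b → c (f b) ≡ e (g b)) → Acyclic X c → Acyclic B g
Acyclic-pullback B X {g = g} {c} f e f-inj f-adj c∘f≡e∘g c-acyclic i j cycle =
  c-acyclic (e i) (e j)
    (CycleIn-map B X {P = λ x → c x ≡ e i ⊎ c x ≡ e j} f f-inj f-adj
      (λ {b} → Sum.map (recolor b) (recolor b)) cycle)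
  where
  recolor : ∀ b {i} → g b ≡ i → c (f b) ≡ e i
  recolor b gb = trans (c∘f≡e∘g b) (cong e gb)

RecoloringStep-proper : ∀ G {k} {c c′ : Fin (n G) → Fin k} {i} → Proper G c
  → RecoloringStep G c i c′ → Proper G c′
RecoloringStep-proper G {c = c} {c′} {i} c-proper (keep , change) u v uv c′u≡c′v
  with c u ≟ᶠ i | c v ≟ᶠ i
... | yes cu | yes cv = c-proper u v uv (trans cu (sym cv))
... | yes cu | no cv = proj₂ (change u cu) v uv (trans c′u≡c′v (keep v cv))
... | no cu | yes cv = proj₂ (change v cv) u (Adj-sym G uv) (trans (sym c′u≡c′v) (keep u cu))
... | no cu | no cv = c-proper u v uv (trans (sym (keep u cu)) (trans c′u≡c′v (keep v cv)))

complete⇒proper-injective : ∀ G {k} {d : Fin (n G) → Fin k} → Complete G → Proper G d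
  → Injective _≡_ _≡_ d
complete⇒proper-injective G complete d-proper {u} {v} du≡dv with u ≟ᶠ v
... | yes u≡v = u≡v
... | no u≢v = ⊥-elim (d-proper u v (complete u v u≢v) du≡dv)

AbColoring : Graph → ℕ → Set
AbColoring G k = Σ (Fin (n G) → Fin k) (IsAbColoring G k)

AbBound : Graph → ℕ → Set
AbBound G m = ∀ k (c : Fin (n G) → Fin k) → IsAbColoring G k c → k ≤ m

IsAb-⊔ : ∀ {G p q} → AbColoring G p → AbColoring G q → AbBound G (p ⊔ q) → IsAb G (p ⊔ q)
IsAb-⊔ {G} {p} {q} p-coloring q-coloring bound with ≤-total p q
... | inj₁ p≤q = subst (AbColoring G) (sym (m≤n⇒m⊔n≡n p≤q)) q-coloring , bound
... | inj₂ q≤p = subst (AbColoring G) (sym (m≥n⇒m⊔n≡m q≤p)) p-coloring , bound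

module MergeNonadjacent {G : Graph} {m} {d : Fin (n G) → Fin m} (d-inj : Injective _≡_ _≡_ d)
                        {u v} (u≢v : u ≢ v) (¬uv : ¬ Adj G u v) where
  merged : Fin (n G) → Fin m
  merged x with x ≟ᶠ u
  ... | yes _ = d v
  ... | no _ = d x

  merged-u : merged u ≡ d v
  merged-u with u ≟ᶠ u
  ... | yes _ = refl
  ... | no u≢u = ⊥-elim (u≢u refl)

  merged-other : ∀ {x} → x ≢ u → merged x ≡ d x
  merged-other {x} x≢u with x ≟ᶠ u
  ... | yes x≡u = ⊥-elim (x≢u x≡u)
  ... | no _ = refl

  no-bVertex : NoBVertex G d (d u)
  no-bVertex x dx isB with d-inj dx
  ... | refl with isB (d v)
  ...   | inj₁ du≡dv = u≢v (d-inj du≡dv)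
  ...   | inj₂ (w , uw , dw≡dv) with d-inj dw≡dv
  ...     | refl = ¬uv uw

  merged-step : RecoloringStep G d (d u) merged
  merged-step = (λ x dx≢du → merged-other (dx≢du ∘ cong d))
              , λ x dx → recolored-u (d-inj dx)
    where
    recolored-u : ∀ {x} → x ≡ u → merged x ≢ d x × (∀ w → Adj G x w → merged x ≢ d w)
    recolored-u refl = (λ dv≡du → u≢v (d-inj (sym (trans (sym merged-u) dv≡du))))
                , (λ w uw dv≡dw → ¬uv (subst (Adj G u) (sym (d-inj (trans (sym merged-u) dv≡dw))) uw))

  merged-acyclic : Proper G d → Acyclic G merged
  merged-acyclic d-proper =
    acyclic-if-one-color-repeats G (d v) (RecoloringStep-proper G d-proper merged-step) used-once
    where
    used-once : ∀ {i x y} → i ≢ d v → merged x ≡ i → merged y ≡ i → x ≡ y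
    used-once {i} i≢dv mx my = d-inj (trans (sym (unmoved mx)) (trans (trans mx (sym my)) (unmoved my)))
      where
      unmoved : ∀ {x} → merged x ≡ i → merged x ≡ d x
      unmoved {x} mx = merged-other λ x≡u → i≢dv (trans (sym mx) (trans (cong merged x≡u) merged-u))

AbColoring-collision : ∀ G {m} {d : Fin (n G) → Fin m} → ¬ Complete G → IsAbColoring G m d → Collision d
AbColoring-collision G {d = d} ¬complete ((d-proper , _) , _ , ¬step) with injective⊎collision d
... | inj₂ collision = collision
... | inj₁ d-inj with ¬Complete⇒nonEdge G ¬complete
...   | u , v , u≢v , ¬uv =
  ⊥-elim (¬step (d u , no-bVertex , merged , merged-step , merged-acyclic d-proper))
  where open MergeNonadjacent {G} d-inj u≢v ¬uv

-- X is the join of A and B, presented abstractly so that the two sides can be exchanged.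
record IsJoin (X A B : Graph) : Set where
  field
    inl : Fin (n A) → Fin (n X)
    inr : Fin (n B) → Fin (n X)
    side : Fin (n X) → Fin (n A) ⊎ Fin (n B)
    side-inl : ∀ a → side (inl a) ≡ inj₁ a
    side-inr : ∀ b → side (inr b) ≡ inj₂ b
    side-inverse : ∀ v → [ inl , inr ]′ (side v) ≡ v
    adj-inl : ∀ a a′ → adj X (inl a) (inl a′) ≡ adj A a a′
    adj-inr : ∀ b b′ → adj X (inr b) (inr b′) ≡ adj B b b′
    Adj-inl-inr : ∀ a b → Adj X (inl a) (inr b)

∨-isJoin : ∀ G H → IsJoin (G ∨ H) G H
∨-isJoin G H = record
  { inl = _↑ˡ n H
  ; inr = n G ↑ʳ_
  ; side = splitAt (n G)
  ; side-inl = λ a → splitAt-↑ˡ (n G) a (n H)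
  ; side-inr = splitAt-↑ʳ (n G) (n H)
  ; side-inverse = join-splitAt (n G) (n H)
  ; adj-inl = adj-inl
  ; adj-inr = adj-inr
  ; Adj-inl-inr = Adj-inl-inr
  }
  where
  adj-inl : ∀ a a′ → adj (G ∨ H) (a ↑ˡ n H) (a′ ↑ˡ n H) ≡ adj G a a′
  adj-inl a a′ rewrite splitAt-↑ˡ (n G) a (n H) | splitAt-↑ˡ (n G) a′ (n H) = refl
  adj-inr : ∀ b b′ → adj (G ∨ H) (n G ↑ʳ b) (n G ↑ʳ b′) ≡ adj H b b′
  adj-inr b b′ rewrite splitAt-↑ʳ (n G) (n H) b | splitAt-↑ʳ (n G) (n H) b′ = refl
  Adj-inl-inr : ∀ a b → Adj (G ∨ H) (a ↑ˡ n H) (n G ↑ʳ b)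
  Adj-inl-inr a b rewrite splitAt-↑ˡ (n G) a (n H) | splitAt-↑ʳ (n G) (n H) b = refl

IsJoin-swap : ∀ {X A B} → IsJoin X A B → IsJoin X B A
IsJoin-swap {X} J = record
  { inl = inr
  ; inr = inl
  ; side = Sum.swap ∘ side
  ; side-inl = cong Sum.swap ∘ side-inr
  ; side-inr = cong Sum.swap ∘ side-inl
  ; side-inverse = λ v → trans (swap-inverse (side v)) (side-inverse v)
  ; adj-inl = adj-inr
  ; adj-inr = adj-inl
  ; Adj-inl-inr = λ b a → Adj-sym X (Adj-inl-inr a b)
  }
  where
  open IsJoin J
  swap-inverse : ∀ s → [ inr , inl ]′ (Sum.swap s) ≡ [ inl , inr ]′ s
  swap-inverse (inj₁ _) = refl
  swap-inverse (inj₂ _) = refl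

module IsJoinProperties {X A B : Graph} (J : IsJoin X A B) where
  open IsJoin J

  view : ∀ v → (∃ λ a → v ≡ inl a) ⊎ (∃ λ b → v ≡ inr b)
  view v with side v | side-inverse v
  ... | inj₁ a | inl-a≡v = inj₁ (a , sym inl-a≡v)
  ... | inj₂ b | inr-b≡v = inj₂ (b , sym inr-b≡v)

  inl-injective : Injective _≡_ _≡_ inl
  inl-injective {a} {a′} eq with trans (sym (side-inl a)) (trans (cong side eq) (side-inl a′))
  ... | refl = refl

  inr-injective : Injective _≡_ _≡_ inr
  inr-injective {b} {b′} eq with trans (sym (side-inr b)) (trans (cong side eq) (side-inr b′))
  ... | refl = refl

  inl≢inr : ∀ a b → inl a ≢ inr b
  inl≢inr a b eq with trans (sym (side-inl a)) (trans (cong side eq) (side-inr b))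
  ... | ()

  inl-Adj⁺ : ∀ {a a′} → Adj A a a′ → Adj X (inl a) (inl a′)
  inl-Adj⁺ {a} {a′} = trans (adj-inl a a′)

  inr-Adj⁺ : ∀ {b b′} → Adj B b b′ → Adj X (inr b) (inr b′)
  inr-Adj⁺ {b} {b′} = trans (adj-inr b b′)

  inr-Adj⁻ : ∀ {b b′} → Adj X (inr b) (inr b′) → Adj B b b′
  inr-Adj⁻ {b} {b′} = trans (sym (adj-inr b b′))

  Adj-inr-inl : ∀ b a → Adj X (inr b) (inl a)
  Adj-inr-inl b a = Adj-sym X (Adj-inl-inr a b)

  Proper-inl : ∀ {k} {c : Fin (n X) → Fin k} → Proper X c → Proper A (c ∘ inl)
  Proper-inl c-proper a a′ aa′ = c-proper (inl a) (inl a′) (inl-Adj⁺ aa′)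

  square : ∀ {P : Fin (n X) → Set} {a a′ b b′} → a ≢ a′ → b ≢ b′
    → P (inl a) → P (inr b) → P (inl a′) → P (inr b′) → CycleIn X P
  square {P} {a} {a′} {b} {b′} a≢a′ b≢b′ p₀ p₁ p₂ p₃ =
    CycleIn-square X {P} distinct p₀ p₁ p₂ p₃
      (Adj-inl-inr a b) (Adj-inr-inl b a′) (Adj-inl-inr a′ b′) (Adj-inr-inl b′ a)
    where
    distinct : Unique (inl a ∷ inr b ∷ inl a′ ∷ inr b′ ∷ [])
    distinct = (inl≢inr a b ∷ a≢a′ ∘ inl-injective ∷ inl≢inr a b′ ∷ [])
             ∷ ((λ eq → inl≢inr a′ b (sym eq)) ∷ b≢b′ ∘ inr-injective ∷ [])
             ∷ (inl≢inr a′ b′ ∷ [])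
             ∷ []
             ∷ []

  acyclic⇒injective-on-a-side : ∀ {k} {c : Fin (n X) → Fin k} → Acyclic X c
    → Injective _≡_ _≡_ (c ∘ inl) ⊎ Injective _≡_ _≡_ (c ∘ inr)
  acyclic⇒injective-on-a-side {c = c} c-acyclic
    with injective⊎collision (c ∘ inl) | injective⊎collision (c ∘ inr)
  ... | inj₁ inl-inj | _ = inj₁ inl-inj
  ... | inj₂ _ | inj₁ inr-inj = inj₂ inr-inj
  ... | inj₂ (a , a′ , a≢a′ , ca≡ca′) | inj₂ (b , b′ , b≢b′ , cb≡cb′) =
    ⊥-elim (c-acyclic (c (inl a)) (c (inr b))
      (square {λ v → c v ≡ c (inl a) ⊎ c v ≡ c (inr b)} a≢a′ b≢b′
        (inj₁ refl) (inj₂ refl) (inj₁ (sym ca≡ca′)) (inj₂ (sym cb≡cb′))))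

  inl-color-used-once : ∀ {k} {d : Fin (n X) → Fin k} → Injective _≡_ _≡_ (d ∘ inl)
    → (∀ a b → d (inl a) ≢ d (inr b))
    → ∀ {a i} → d (inl a) ≡ i → ∀ {x y} → d x ≡ i → d y ≡ i → x ≡ y
  inl-color-used-once {d = d} d-inl-inj disjoint {a} {i} da dx dy = trans (is-inl-a dx) (sym (is-inl-a dy))
    where
    is-inl-a : ∀ {x} → d x ≡ i → x ≡ inl a
    is-inl-a {x} dx with view x
    ... | inj₁ (a′ , refl) = cong inl (d-inl-inj (trans dx (sym da)))
    ... | inj₂ (b , refl) = ⊥-elim (disjoint a b (trans da (sym dx)))

  -- A cycle in two colors either passes through A, where each color is used once, or lies in B.
  acyclic-join : ∀ {k} {d : Fin (n X) → Fin k} → Proper X d → Injective _≡_ _≡_ (d ∘ inl)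
    → (∀ a b → d (inl a) ≢ d (inr b)) → Acyclic B (d ∘ inr) → Acyclic X d
  acyclic-join {d = d} d-proper d-inl-inj disjoint B-acyclic i j cycle
    with any? (λ a → d (inl a) ≟ᶠ i) | any? (λ a → d (inl a) ≟ᶠ j)
  ... | yes (_ , da) | _ =
    unique-color⇒¬CycleIn X d-proper (inl-color-used-once d-inl-inj disjoint da) cycle
  ... | no _ | yes (_ , da) =
    unique-color⇒¬CycleIn X d-proper (inl-color-used-once d-inl-inj disjoint da)
      (CycleIn-mono X {Q = λ v → d v ≡ j ⊎ d v ≡ i} Sum.swap cycle)
  ... | no i∉A | no j∉A = B-acyclic i j (CycleIn-pull B X inr inr-Adj⁻ in-B cycle)
    where
    in-B : ∀ {v} → d v ≡ i ⊎ d v ≡ j → ∃ λ b → inr b ≡ v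
    in-B {v} dv with view v
    ... | inj₂ (b , refl) = b , refl
    ... | inj₁ (a , refl) = ⊥-elim ([ (λ da → i∉A (a , da)) , (λ da → j∉A (a , da)) ]′ dv)

module Restriction {X A B : Graph} (J : IsJoin X A B) {k} (c : Fin (n X) → Fin k)
                   (c-proper : Proper X c) where
  open IsJoin J
  open IsJoinProperties J
  open ImageFactorization (imageFactorization (c ∘ inr)) public

  inl≢into : ∀ a y → c (inl a) ≢ into y
  inl≢into a y eq with onto-surjective y
  ... | b , refl = c-proper (inl a) (inr b) (Adj-inl-inr a b) (trans eq (sym (factors b)))

  into-colored : ∀ {v y} → c v ≡ into y → ∃ λ b → v ≡ inr b × onto b ≡ y
  into-colored {v} cv with view v
  ... | inj₁ (a , refl) = ⊥-elim (inl≢into a _ cv)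
  ... | inj₂ (b , refl) = b , refl , into-injective (trans (sym (factors b)) cv)

  onto-proper : Proper B onto
  onto-proper u v uv eq =
    c-proper (inr u) (inr v) (inr-Adj⁺ uv) (trans (factors u) (trans (cong into eq) (sym (factors v))))

  onto-acyclic : Acyclic X c → Acyclic B onto
  onto-acyclic = Acyclic-pullback B X {c = c} inr into inr-injective inr-Adj⁺ factors

  IsBVertex-inr⁻ : ∀ {b} → IsBVertex X c (inr b) → IsBVertex B onto b
  IsBVertex-inr⁻ {b} isB j with isB (into j)
  ... | inj₁ cb = inj₁ (into-injective (trans (sym (factors b)) cb))
  ... | inj₂ (u , bu , cu) with into-colored cu
  ...   | b′ , refl , onto-b′ = inj₂ (b′ , inr-Adj⁻ bu , onto-b′)

  colors-bound : AllColorsUsed X c → k ≤ size + n A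
  colors-bound c-onto = surjective⇒≤ color color-onto
    where
    color : Fin (size + n A) → Fin k
    color x = [ into , c ∘ inl ]′ (splitAt size x)
    color-onto : ∀ j → ∃ λ x → color x ≡ j
    color-onto j with c-onto j
    ... | v , refl with view v
    ...   | inj₁ (a , refl) =
      size ↑ʳ a , cong [ into , c ∘ inl ]′ (splitAt-↑ʳ size (n A) a)
    ...   | inj₂ (b , refl) =
      onto b ↑ˡ n A , trans (cong [ into , c ∘ inl ]′ (splitAt-↑ˡ size (onto b) (n A))) (sym (factors b))

  module Lift (c-inl-inj : Injective _≡_ _≡_ (c ∘ inl)) {i} {c″ : Fin (n B) → Fin size}
              (step : RecoloringStep B onto i c″) where
    lifted : Fin (n X) → Fin k
    lifted v = [ c ∘ inl , into ∘ c″ ]′ (side v)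

    lifted-inl : ∀ a → lifted (inl a) ≡ c (inl a)
    lifted-inl a = cong [ c ∘ inl , into ∘ c″ ]′ (side-inl a)

    lifted-inr : ∀ b → lifted (inr b) ≡ into (c″ b)
    lifted-inr b = cong [ c ∘ inl , into ∘ c″ ]′ (side-inr b)

    lifted-step : RecoloringStep X c (into i) lifted
    lifted-step = keep , change
      where
      open ≡-Reasoning
      keep : ∀ v → c v ≢ into i → lifted v ≡ c v
      keep v cv≢i with view v
      ... | inj₁ (a , refl) = lifted-inl a
      ... | inj₂ (b , refl) = begin
        lifted (inr b)  ≡⟨ lifted-inr b ⟩
        into (c″ b)     ≡⟨ cong into (proj₁ step b (cv≢i ∘ trans (factors b) ∘ cong into)) ⟩
        into (onto b)   ≡⟨ sym (factors b) ⟩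
        c (inr b)       ∎
      change : ∀ v → c v ≡ into i → lifted v ≢ c v × (∀ u → Adj X v u → lifted v ≢ c u)
      change v cv with into-colored cv
      ... | b , refl , onto-b = moved , avoids
        where
        recolored = proj₂ step b onto-b
        moved : lifted (inr b) ≢ c (inr b)
        moved eq = proj₁ recolored (into-injective (trans (sym (lifted-inr b)) (trans eq (factors b))))
        avoids : ∀ u → Adj X (inr b) u → lifted (inr b) ≢ c u
        avoids u bu eq with view u
        ... | inj₁ (a , refl) = inl≢into a (c″ b) (trans (sym eq) (lifted-inr b))
        ... | inj₂ (b′ , refl) = proj₂ recolored b′ (inr-Adj⁻ bu)
          (into-injective (trans (sym (lifted-inr b)) (trans eq (factors b′))))

    lifted-acyclic : Acyclic B c″ → Acyclic X lifted
    lifted-acyclic c″-acyclic =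
      acyclic-join (RecoloringStep-proper X c-proper lifted-step)
        (λ {a} {a′} eq → c-inl-inj (trans (sym (lifted-inl a)) (trans eq (lifted-inl a′))))
        (λ a b eq → inl≢into a (c″ b) (trans (sym (lifted-inl a)) (trans eq (lifted-inr b))))
        (Acyclic-reindex B into into-injective lifted-inr c″-acyclic)

  lift-step : Injective _≡_ _≡_ (c ∘ inl) → AcyclicStepApplicable B onto → AcyclicStepApplicable X c
  lift-step c-inl-inj (i , no-bVertex , c″ , step , c″-acyclic) =
    into i , no-bVertex′ , lifted , lifted-step , lifted-acyclic c″-acyclic
    where
    open Lift c-inl-inj step
    no-bVertex′ : NoBVertex X c (into i)
    no-bVertex′ v cv isB with into-colored cv
    ... | b , refl , onto-b = no-bVertex b onto-b (IsBVertex-inr⁻ isB)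

join-AbColoring-bound : ∀ {X A B} (J : IsJoin X A B) {b} → AbBound B b
  → ∀ {k} {c : Fin (n X) → Fin k} → IsAbColoring X k c → Injective _≡_ _≡_ (c ∘ IsJoin.inl J)
  → k ≤ b + n A
join-AbColoring-bound {A = A} {B} J B-bound {c = c} ((c-proper , c-onto) , c-acyclic , ¬step) c-inl-inj =
  ≤-trans (colors-bound c-onto) (+-monoˡ-≤ (n A) (B-bound size onto onto-AbColoring))
  where
  open Restriction J c c-proper
  onto-AbColoring : IsAbColoring B size onto
  onto-AbColoring = (onto-proper , onto-surjective) , onto-acyclic c-acyclic , ¬step ∘ lift-step c-inl-inj

module Extension {X A B : Graph} (J : IsJoin X A B) {m} (d : Fin (n B) → Fin m) where
  open IsJoin J
  open IsJoinProperties J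

  color : Fin (n X) → Fin (m + n A)
  color v = [ m ↑ʳ_ , (_↑ˡ n A) ∘ d ]′ (side v)

  color-inl : ∀ a → color (inl a) ≡ m ↑ʳ a
  color-inl a = cong [ m ↑ʳ_ , (_↑ˡ n A) ∘ d ]′ (side-inl a)

  color-inr : ∀ b → color (inr b) ≡ d b ↑ˡ n A
  color-inr b = cong [ m ↑ʳ_ , (_↑ˡ n A) ∘ d ]′ (side-inr b)

  color-inl-injective : Injective _≡_ _≡_ (color ∘ inl)
  color-inl-injective {a} {a′} eq =
    ↑ʳ-injective m a a′ (trans (sym (color-inl a)) (trans eq (color-inl a′)))

  color-inl≢inr : ∀ a b → color (inl a) ≢ color (inr b)
  color-inl≢inr a b eq = ↑ˡ≢↑ʳ (d b) a (sym (trans (sym (color-inl a)) (trans eq (color-inr b))))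

  color-proper : Proper B d → Proper X color
  color-proper d-proper u v uv eq with view u | view v
  ... | inj₁ (a , refl) | inj₁ (a′ , refl) = Adj⇒≢ X uv (cong inl (color-inl-injective eq))
  ... | inj₁ (a , refl) | inj₂ (b , refl) = color-inl≢inr a b eq
  ... | inj₂ (b , refl) | inj₁ (a , refl) = color-inl≢inr a b (sym eq)
  ... | inj₂ (b , refl) | inj₂ (b′ , refl) = d-proper b b′ (inr-Adj⁻ uv)
    (↑ˡ-injective (n A) _ _ (trans (sym (color-inr b)) (trans eq (color-inr b′))))

  color-onto : AllColorsUsed B d → AllColorsUsed X color
  color-onto d-onto j with ↑-view m (n A) j
  ... | inj₂ (a , refl) = inl a , color-inl a
  ... | inj₁ (y , refl) with d-onto y
  ...   | b , refl = inr b , color-inr b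

  color-acyclic : Proper B d → Acyclic B d → Acyclic X color
  color-acyclic d-proper d-acyclic =
    acyclic-join (color-proper d-proper) color-inl-injective color-inl≢inr
      (Acyclic-reindex B (_↑ˡ n A) (↑ˡ-injective (n A) _ _) color-inr d-acyclic)

  IsBVertex-inr⁺ : ∀ {b} → IsBVertex B d b → IsBVertex X color (inr b)
  IsBVertex-inr⁺ {b} isB j with ↑-view m (n A) j
  ... | inj₂ (a , refl) = inj₂ (inl a , Adj-inr-inl b a , color-inl a)
  ... | inj₁ (y , refl) with isB y
  ...   | inj₁ db = inj₁ (trans (color-inr b) (cong (_↑ˡ n A) db))
  ...   | inj₂ (u , bu , du) = inj₂ (inr u , inr-Adj⁺ bu , trans (color-inr u) (cong (_↑ˡ n A) du))

  ¬step-on-inl-color : AllColorsUsed B d → Complete A ⊎ Collision d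
    → ∀ {a₀ c′} → RecoloringStep X color (m ↑ʳ a₀) c′ → ¬ Acyclic X c′
  ¬step-on-inl-color d-onto complete⊎collision {a₀} {c′} (keep , change) c′-acyclic =
    recolored-to (↑-view m (n A) (c′ (inl a₀)))
    where
    moved = proj₁ (change (inl a₀) (color-inl a₀))
    avoids = proj₂ (change (inl a₀) (color-inl a₀))

    unchanged-inl : ∀ {a} → a₀ ≢ a → c′ (inl a) ≡ m ↑ʳ a
    unchanged-inl {a} a₀≢a =
      trans (keep (inl a) (a₀≢a ∘ sym ∘ ↑ʳ-injective m a a₀ ∘ trans (sym (color-inl a)))) (color-inl a)

    unchanged-inr : ∀ b → c′ (inr b) ≡ d b ↑ˡ n A
    unchanged-inr b = trans (keep (inr b) (↑ˡ≢↑ʳ (d b) a₀ ∘ trans (sym (color-inr b)))) (color-inr b)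

    recolored-to-nonneighbor : ∀ {a₁} → a₀ ≢ a₁ → ¬ Adj A a₀ a₁ → c′ (inl a₀) ≢ m ↑ʳ a₁
    recolored-to-nonneighbor {a₁} a₀≢a₁ ¬a₀a₁ eq =
      [ (λ complete → ¬a₀a₁ (complete a₀ a₁ a₀≢a₁)) , two-colored-square ]′ complete⊎collision
      where
      two-colored-square : Collision d → ⊥
      two-colored-square (u , v , u≢v , du≡dv) =
        c′-acyclic (m ↑ʳ a₁) (d u ↑ˡ n A)
          (square {λ x → c′ x ≡ m ↑ʳ a₁ ⊎ c′ x ≡ d u ↑ˡ n A} a₀≢a₁ u≢v
            (inj₁ eq) (inj₂ (unchanged-inr u)) (inj₁ (unchanged-inl a₀≢a₁))
            (inj₂ (trans (unchanged-inr v) (cong (_↑ˡ n A) (sym du≡dv)))))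

    recolored-to : (∃ λ y → c′ (inl a₀) ≡ y ↑ˡ n A) ⊎ (∃ λ a₁ → c′ (inl a₀) ≡ m ↑ʳ a₁) → ⊥
    recolored-to (inj₁ (y , eq)) with d-onto y
    ... | b , refl = avoids (inr b) (Adj-inl-inr a₀ b) (trans eq (sym (color-inr b)))
    recolored-to (inj₂ (a₁ , eq)) with a₀ ≟ᶠ a₁ | Adj? A a₀ a₁
    ... | yes refl | _ = moved (trans eq (sym (color-inl a₀)))
    ... | no _ | yes a₀a₁ = avoids (inl a₁) (inl-Adj⁺ a₀a₁) (trans eq (sym (color-inl a₁)))
    ... | no a₀≢a₁ | no ¬a₀a₁ = recolored-to-nonneighbor a₀≢a₁ ¬a₀a₁ eq

  module Restrict {i : Fin m} {c′ : Fin (n X) → Fin (m + n A)}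
                  (step : RecoloringStep X color (i ↑ˡ n A) c′) where
    keep = proj₁ step
    change = proj₂ step

    -- the second branch is never taken (restricted-inr)
    restricted : Fin (n B) → Fin m
    restricted b = [ id , (λ _ → d b) ]′ (splitAt m (c′ (inr b)))

    inr-keeps-B-color : ∀ b a → c′ (inr b) ≢ m ↑ʳ a
    inr-keeps-B-color b a eq with color (inr b) ≟ᶠ i ↑ˡ n A
    ... | yes recolored =
      proj₂ (change (inr b) recolored) (inl a) (Adj-inr-inl b a) (trans eq (sym (color-inl a)))
    ... | no kept = ↑ˡ≢↑ʳ (d b) a (trans (sym (color-inr b)) (trans (sym (keep (inr b) kept)) eq))

    restricted-inr : ∀ b → c′ (inr b) ≡ restricted b ↑ˡ n A
    restricted-inr b with ↑-view m (n A) (c′ (inr b))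
    ... | inj₁ (y , eq) rewrite eq | splitAt-↑ˡ m y (n A) = refl
    ... | inj₂ (a , eq) = ⊥-elim (inr-keeps-B-color b a eq)

    restricted≡d⇒ : ∀ {b u} → restricted b ≡ d u → c′ (inr b) ≡ color (inr u)
    restricted≡d⇒ {b} {u} eq = trans (restricted-inr b) (trans (cong (_↑ˡ n A) eq) (sym (color-inr u)))

    restricted-step : RecoloringStep B d i restricted
    restricted-step = keep′ , change′
      where
      keep′ : ∀ b → d b ≢ i → restricted b ≡ d b
      keep′ b db≢i = ↑ˡ-injective (n A) _ _
        (trans (sym (restricted-inr b)) (trans (keep (inr b) kept) (color-inr b)))
        where
        kept : color (inr b) ≢ i ↑ˡ n A
        kept = db≢i ∘ ↑ˡ-injective (n A) _ _ ∘ trans (sym (color-inr b))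
      change′ : ∀ b → d b ≡ i → restricted b ≢ d b × (∀ u → Adj B b u → restricted b ≢ d u)
      change′ b db = proj₁ recolored ∘ restricted≡d⇒
                   , λ u bu → proj₂ recolored (inr u) (inr-Adj⁺ bu) ∘ restricted≡d⇒
        where
        recolored = change (inr b) (trans (color-inr b) (cong (_↑ˡ n A) db))

    restricted-acyclic : Acyclic X c′ → Acyclic B restricted
    restricted-acyclic = Acyclic-pullback B X {c = c′} inr (_↑ˡ n A) inr-injective inr-Adj⁺ restricted-inr

  restrict-step : ∀ {i c′} → NoBVertex X color (i ↑ˡ n A) → RecoloringStep X color (i ↑ˡ n A) c′
    → Acyclic X c′ → AcyclicStepApplicable B d
  restrict-step {i} no-bVertex step c′-acyclic =
    i , no-bVertex′ , restricted , restricted-step , restricted-acyclic c′-acyclic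
    where
    open Restrict step
    no-bVertex′ : NoBVertex B d i
    no-bVertex′ b db isB = no-bVertex (inr b) (trans (color-inr b) (cong (_↑ˡ n A) db)) (IsBVertex-inr⁺ isB)

  color-AbColoring : IsAbColoring B m d → Complete A ⊎ Collision d → IsAbColoring X (m + n A) color
  color-AbColoring ((d-proper , d-onto) , d-acyclic , ¬step) complete⊎collision =
    (color-proper d-proper , color-onto d-onto) , color-acyclic d-proper d-acyclic , ¬step′
    where
    ¬step′ : ¬ AcyclicStepApplicable X color
    ¬step′ (i , no-bVertex , c′ , step , c′-acyclic) with ↑-view m (n A) i
    ... | inj₁ (y , refl) = ¬step (restrict-step no-bVertex step c′-acyclic)
    ... | inj₂ (a , refl) = ¬step-on-inl-color d-onto complete⊎collision step c′-acyclic

Ab-∨ : ∀ G H → ¬ Complete G → ¬ Complete H → ∀ {a b}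
  → IsAb G a → IsAb H b → IsAb (G ∨ H) ((a + n H) ⊔ (b + n G))
Ab-∨ G H ¬complete-G ¬complete-H {a} {b} ((cG , cG-ab) , G-bound) ((cH , cH-ab) , H-bound) =
  IsAb-⊔ {G ∨ H}
    (_ , Extension.color-AbColoring J′ cG cG-ab (inj₂ (AbColoring-collision G ¬complete-G cG-ab)))
    (_ , Extension.color-AbColoring J cH cH-ab (inj₂ (AbColoring-collision H ¬complete-H cH-ab)))
    bound
  where
  J = ∨-isJoin G H
  J′ = IsJoin-swap J
  bound : AbBound (G ∨ H) ((a + n H) ⊔ (b + n G))
  bound k c c-ab@(_ , c-acyclic , _)
    with IsJoinProperties.acyclic⇒injective-on-a-side J {c = c} c-acyclic
  ... | inj₁ G-inj = ≤-trans (join-AbColoring-bound J H-bound c-ab G-inj) (m≤n⊔m _ _)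
  ... | inj₂ H-inj = ≤-trans (join-AbColoring-bound J′ G-bound c-ab H-inj) (m≤m⊔n _ _)

Ab-∨-K : ∀ G q {a} → IsAb G a → IsAb (G ∨ K q) (a + q)
Ab-∨-K G q {a} ((cG , cG-ab) , G-bound) =
  (_ , Extension.color-AbColoring J cG cG-ab (inj₁ (K-complete q))) , bound
  where
  J = IsJoin-swap (∨-isJoin G (K q))
  bound : AbBound (G ∨ K q) (a + q)
  bound k c c-ab@((c-proper , _) , _) = join-AbColoring-bound J G-bound c-ab
    (complete⇒proper-injective (K q) (K-complete q) (IsJoinProperties.Proper-inl J c-proper))

theorem5 :
    (∀ (G H : Graph) → ¬ Complete G → ¬ Complete H → ∀ (a b : ℕ)
       → IsAb G a → IsAb H b → IsAb (G ∨ H) ((a + n H) ⊔ (b + n G)))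
    × (∀ (G : Graph) (q : ℕ) → 1 ≤ q → ∀ (a : ℕ)
       → IsAb G a → IsAb (G ∨ K q) (a + q))
theorem5 = (λ G H ¬complete-G ¬complete-H _ _ → Ab-∨ G H ¬complete-G ¬complete-H)
         , (λ G q _ _ → Ab-∨-K G q)
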